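{- For $m\ge3$ and $n\geq 2$, the zero-free chromatic polynomial of $B^{uv}(m,n)=(B(m,n),\{uv\})$ satisfies \[\chi^b_{B^{uv}(m,n)}(\lambda)=(\lambda-1)\gamma_{m-1}\chi^b_{B^{uv}(m,n-1)}(\lambda)+(-1)^{m-2}\lambda(\lambda-2)\gamma_m^{n-1}\] and equals \[\lambda(\lambda-1)^{n-1}\gamma_{m-1}^{n-1}\gamma_{m+1}+(-1)^{m-2}\lambda(\lambda-2)\gamma_m\frac{(\lambda-1)^{n-1}\gamma_{m-1}^{n-1}-\gamma_m^{n-1}}{(\lambda-1)\gamma_{m-1}-\gamma_m},\] where $\gamma_j=\frac{(\lambda-1)^{j-1}-(-1)^{j-1}}{\lambda}$ for $j\ge2$.
   Context: The book graph $B(m,n)$ has vertices $\{u,v\}\cup\{u_j^i:1\le i\le n,1\le j\le m-2\}$ and consists of the $n$ cycles $uu_1^i\cdots u_{m-2}^ivu$ sharing the edge $uv$; $B^{uv}(m,n)$ is the signed graph on $B(m,n)$ whose only negative edge is $uv$. A zero-free coloring in $2k$ signed colors is a map $c:V\to\{ -k,\ldots,-1,1,\ldots,k\}$, proper if $c(x)\ne\sigma(e)c(y)$ for every edge $e=xy$; the zero-free chromatic polynomial is the polynomial whose value at $\lambda=2k$ counts proper zero-free colorings. -}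

module Defs where

import Data.Nat as ℕ
open ℕ using (ℕ; zero; suc; _∸_)
open import Data.Fin as Fin using (Fin; inject₁; fromℕ; combine)
open import Data.Fin.Base using () renaming (zero to fz; suc to fs)
open import Data.Integer as ℤ using (ℤ)
open import Data.Sign using (Sign)
open import Data.List using (List; []; _∷_; map; concatMap; filter; length; cartesianProduct; allFin; _++_)
open import Data.List.Relation.Unary.All using (All; all?)
open import Data.Vec using (Vec; lookup) renaming ([] to []ᵥ; _∷_ to _∷ᵥ_)
open import Data.Product using (_×_; _,_)
open import Relation.Nullary using (¬_; ¬?)
open import Relation.Binary.PropositionalEquality using (_≡_; _≢_)
open import Data.Rational as ℚ using (ℚ; 0ℚ; 1ℚ; _÷_; ≢-nonZero)
open import Data.Rational.Properties using () renaming (_≟_ to _≟ℚ_)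
open import Relation.Nullary using (yes; no)

Edge : ℕ → Set
Edge N = Fin N × Fin N × Sign

infixr 7 _·_
_·_ : Sign → ℤ → ℤ
Sign.+ · x = x
Sign.- · x = ℤ.- x

-- Zero-free signed colours with 2k colours: {-k,…,-1,1,…,k}.
-- A colour is a pair (s , i) with s a sign and i : Fin k, denoting s·(i+1).

Colour : ℕ → Set
Colour k = Sign × Fin k

value : ∀ {k} → Colour k → ℤ
value (s , i) = s · (ℤ.+ (suc (Fin.toℕ i)))

allColours : (k : ℕ) → List (Colour k)
allColours k = cartesianProduct (Sign.+ ∷ Sign.- ∷ []) (allFin k)

allVecs : ∀ {A : Set} (N : ℕ) → List A → List (Vec A N)
allVecs zero    xs = []ᵥ ∷ []
allVecs (suc N) xs = concatMap (λ a → map (a ∷ᵥ_) (allVecs N xs)) xs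

ProperEdge : ∀ {N k} → Vec (Colour k) N → Edge N → Set
ProperEdge c (x , y , σ) = value (lookup c x) ≢ σ · value (lookup c y)

Proper : ∀ {N k} → List (Edge N) → Vec (Colour k) N → Set
Proper E c = All (ProperEdge c) E

proper? : ∀ {N k} (E : List (Edge N)) (c : Vec (Colour k) N) → Relation.Nullary.Dec (Proper E c)
proper? E c = all? (λ { (x , y , σ) → ¬? (value (lookup c x) ℤ.≟ σ · value (lookup c y)) }) E

-- number of proper zero-free colourings in 2k signed colours
-- (= value of the zero-free chromatic polynomial at λ = 2k)
countProper : ∀ {N} → List (Edge N) → ℕ → ℕ
countProper {N} E k = length (filter (proper? E) (allVecs N (allColours k)))

-- The book graph B(m,n) with its signature {uv}.
-- Vertices: Fin (2 + n * (m ∸ 2)); u = 0, v = 1,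
-- u^i_j = 2 + combine i j  (i : Fin n, j : Fin (m ∸ 2), both 0-based).

BV : ℕ → ℕ → ℕ
BV m n = 2 ℕ.+ n ℕ.* (m ∸ 2)

bookU : ∀ m n → Fin (BV m n)
bookU m n = fz

bookV : ∀ m n → Fin (BV m n)
bookV m n = fs fz

bookW : ∀ m n → Fin n → Fin (m ∸ 2) → Fin (BV m n)
bookW m n i j = fs (fs (combine i j))

-- edges of B^{uv}(m,n): uv negative; for each page i the path
-- u – u^i_1 – … – u^i_{m-2} – v, all positive.  Only meaningful for m ≥ 3
-- (for m < 3 we just return the edge uv; these cases are excluded by hypothesis).
bookEdges : (m n : ℕ) → List (Edge (BV m n))
bookEdges (suc (suc (suc p))) n =
  (bookU m n , bookV m n , Sign.-) ∷
  concatMap (λ i →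
      (bookU m n , bookW m n i fz , Sign.+)
    ∷ (bookW m n i (fromℕ p) , bookV m n , Sign.+)
    ∷ map (λ j → (bookW m n i (inject₁ j) , bookW m n i (fs j) , Sign.+)) (allFin p))
    (allFin n)
  where m = suc (suc (suc p))
bookEdges m n = (bookU m n , bookV m n , Sign.-) ∷ []

χbook : (m n k : ℕ) → ℕ
χbook m n k = countProper (bookEdges m n) k

infixr 8 _^_
infixl 7 _/'_

_^_ : ℚ → ℕ → ℚ
x ^ zero  = 1ℚ
x ^ suc n = x ℚ.* (x ^ n)

-- total division (x / 0 := 0); only ever used with nonzero denominators here
_/'_ : ℚ → ℚ → ℚ
x /' y with y ≟ℚ 0ℚ
... | yes _  = 0ℚ
... | no y≢0 = _÷_ x y {{≢-nonZero y≢0}}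

γ : ℕ → ℚ → ℚ
γ j x = ((x ℚ.- 1ℚ) ^ (j ∸ 1) ℚ.- (ℚ.- 1ℚ) ^ (j ∸ 1)) /' x

ℕtoℚ : ℕ → ℚ
ℕtoℚ n = ℤ.+ n ℚ./ 1

twice : ℕ → ℚ
twice k = ℕtoℚ (2 ℕ.* k)

module Submission where

-- Colour the spine first: u gets a and v gets b, where the negative edge only forbids
-- b = −a.  Each page is then a path u w₁ … w_{m−2} v of positive edges, whose interior has
-- E proper colourings if a = b and D if a ≠ b (walk counts in the complete graph on the
-- λ colours).  As −a ≠ a for zero-free colours, b = a contributes E^n and each of the λ − 2
-- colours b ∉ {a, −a} contributes D^n, so χ = λ(E^n + (λ − 2)D^n).  The walk recursions give
-- D = γ_m and E = (λ − 1)γ_{m−1}, and together with γ_m = (λ − 1)γ_{m−1} + (−1)^{m−2} and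
-- γ_{m+1} = (λ − 1)γ_{m−1} + (λ − 2)γ_m both formulas become ring identities in
-- χ = λ(((λ − 1)γ_{m−1})^n + (λ − 2)γ_m^n).

module ColouringCounts where

  open import Data.Nat using (ℕ; zero; suc; _+_; _*_; _^_)
  open import Data.Nat.Properties using (+-commutativeSemigroup; +-cancelˡ-≡; +-assoc; *-distribˡ-+; *-zeroʳ; *-comm; *-identityˡ; +-identityʳ)
  open import Data.Fin using (Fin; combine; fromℕ; inject₁)
  open import Data.Fin.Base using () renaming (zero to fz; suc to fs)
  import Data.Fin.Properties as Fin
  open import Data.List using (List; []; _∷_; _++_; map; concatMap; filter; length)
  open import Data.List.Membership.Propositional using (_∈_)
  open import Data.List.Relation.Unary.All as All using (All; []; _∷_)
  open import Data.List.Relation.Unary.Any using (here; there)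
  open import Data.List.Relation.Unary.Unique.Propositional using (Unique; []; _∷_)
  open import Data.Vec as Vec using (Vec; []; _∷_; tabulate)
  open import Data.Vec.Properties using (lookup-++ˡ; lookup-++ʳ; tabulate∘lookup; tabulate-cong)
  open import Data.Product using (_×_; _,_; proj₁; proj₂)
  open import Data.Nat.Tactic.RingSolver using (solve-∀)
  open import Algebra.Properties.CommutativeSemigroup +-commutativeSemigroup using () renaming (interchange to +-interchange)
  open import Function using (id; _∘_; case_of_; _⇔_; Equivalence; mk⇔)
  open import Relation.Binary.Definitions using (DecidableEquality)
  open import Relation.Binary.PropositionalEquality
  open import Relation.Nullary using (Dec; yes; no; ¬_; ¬?; _×-dec_)
  open import Data.Empty using (⊥-elim)
  open import Defs using (allVecs)

  𝟙 : {P : Set} → Dec P → ℕ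
  𝟙 (yes _) = 1
  𝟙 (no _)  = 0

  𝟙-yes : {P : Set} → P → (p : Dec P) → 𝟙 p ≡ 1
  𝟙-yes _ (yes _) = refl
  𝟙-yes x (no ¬x) = ⊥-elim (¬x x)

  𝟙-no : {P : Set} → ¬ P → (p : Dec P) → 𝟙 p ≡ 0
  𝟙-no ¬x (yes x) = ⊥-elim (¬x x)
  𝟙-no _  (no _)  = refl

  𝟙-⇔ : {P Q : Set} → P ⇔ Q → (p : Dec P) (q : Dec Q) → 𝟙 p ≡ 𝟙 q
  𝟙-⇔ P⇔Q (yes x) q = sym (𝟙-yes (Equivalence.to P⇔Q x) q)
  𝟙-⇔ P⇔Q (no ¬x) q = sym (𝟙-no (¬x ∘ Equivalence.from P⇔Q) q)

  𝟙-× : {P Q : Set} (p : Dec P) (q : Dec Q) → 𝟙 (p ×-dec q) ≡ 𝟙 p * 𝟙 q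
  𝟙-× (yes _) (yes _) = refl
  𝟙-× (yes _) (no _)  = refl
  𝟙-× (no _)  _       = refl

  𝟙-+-𝟙¬ : {P : Set} (p : Dec P) (y : ℕ) → 𝟙 p * y + 𝟙 (¬? p) * y ≡ y
  𝟙-+-𝟙¬ (yes _) y = trans (+-identityʳ (y + 0)) (+-identityʳ y)
  𝟙-+-𝟙¬ (no _)  y = +-identityʳ y

  ∑ : {A : Set} → List A → (A → ℕ) → ℕ
  ∑ []       f = 0
  ∑ (x ∷ xs) f = f x + ∑ xs f

  infix 5 ∑
  syntax ∑ xs (λ x → e) = ∑[ x ∈ xs ] e

  private
    variable
      A B : Set

  length-filter : {P : A → Set} (P? : ∀ x → Dec (P x)) (xs : List A) →
                  length (filter P? xs) ≡ ∑[ x ∈ xs ] 𝟙 (P? x)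
  length-filter P? []       = refl
  length-filter P? (x ∷ xs) with P? x
  ... | yes _ = cong suc (length-filter P? xs)
  ... | no  _ = length-filter P? xs

  ∑-cong : {f g : A → ℕ} → (∀ x → f x ≡ g x) → ∀ xs → ∑ xs f ≡ ∑ xs g
  ∑-cong f≗g []       = refl
  ∑-cong f≗g (x ∷ xs) = cong₂ _+_ (f≗g x) (∑-cong f≗g xs)

  ∑-++ : ∀ xs ys (f : A → ℕ) → ∑ (xs ++ ys) f ≡ ∑ xs f + ∑ ys f
  ∑-++ []       ys f = refl
  ∑-++ (x ∷ xs) ys f = trans (cong (f x +_) (∑-++ xs ys f)) (sym (+-assoc (f x) _ _))

  ∑-+ : ∀ (xs : List A) f g → ∑[ x ∈ xs ] (f x + g x) ≡ ∑ xs f + ∑ xs g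
  ∑-+ []       f g = refl
  ∑-+ (x ∷ xs) f g = trans (cong (f x + g x +_) (∑-+ xs f g)) (+-interchange (f x) (g x) (∑ xs f) (∑ xs g))

  ∑-*ˡ : ∀ c xs (f : A → ℕ) → ∑[ x ∈ xs ] c * f x ≡ c * ∑ xs f
  ∑-*ˡ c []       f = sym (*-zeroʳ c)
  ∑-*ˡ c (x ∷ xs) f = trans (cong (c * f x +_) (∑-*ˡ c xs f)) (sym (*-distribˡ-+ c (f x) _))

  ∑-*ʳ : ∀ c xs (f : A → ℕ) → ∑[ x ∈ xs ] f x * c ≡ ∑ xs f * c
  ∑-*ʳ c xs f = trans (∑-cong (λ x → *-comm (f x) c) xs) (trans (∑-*ˡ c xs f) (*-comm c _))

  ∑-const : ∀ c (xs : List A) → ∑[ _ ∈ xs ] c ≡ length xs * c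
  ∑-const c []       = refl
  ∑-const c (x ∷ xs) = cong (c +_) (∑-const c xs)

  ∑-map : (g : B → A) (xs : List B) (f : A → ℕ) → ∑ (map g xs) f ≡ ∑ xs (f ∘ g)
  ∑-map g []       f = refl
  ∑-map g (x ∷ xs) f = cong (f (g x) +_) (∑-map g xs f)

  ∑-concatMap : (g : B → List A) (xs : List B) (f : A → ℕ) →
                ∑ (concatMap g xs) f ≡ ∑[ x ∈ xs ] ∑ (g x) f
  ∑-concatMap g []       f = refl
  ∑-concatMap g (x ∷ xs) f = trans (∑-++ (g x) _ f) (cong (∑ (g x) f +_) (∑-concatMap g xs f))

  module _ (_≟_ : DecidableEquality A) where

    ∑-𝟙≟-absent : ∀ {a xs} → All (λ x → a ≢ x) xs → ∑[ x ∈ xs ] 𝟙 (a ≟ x) ≡ 0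
    ∑-𝟙≟-absent {a} {x ∷ xs} (a≢x ∷ a∉xs) = cong₂ _+_ (𝟙-no a≢x (a ≟ x)) (∑-𝟙≟-absent a∉xs)
    ∑-𝟙≟-absent {xs = []} [] = refl

    ∑-𝟙≟-unique : ∀ {a xs} → Unique xs → a ∈ xs → ∑[ x ∈ xs ] 𝟙 (a ≟ x) ≡ 1
    ∑-𝟙≟-unique {a} {x ∷ xs} (x∉xs ∷ _) (here refl) = cong₂ _+_ (𝟙-yes refl (a ≟ a)) (∑-𝟙≟-absent x∉xs)
    ∑-𝟙≟-unique {a} {x ∷ xs} (x∉xs ∷ xs-unique) (there a∈xs) =
      cong₂ _+_ (𝟙-no (λ a≡x → All.lookup x∉xs a∈xs (sym a≡x)) (a ≟ x)) (∑-𝟙≟-unique xs-unique a∈xs)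

  ∑-allVecs-suc : ∀ N (cs : List A) (f : Vec A (suc N) → ℕ) →
                  ∑ (allVecs (suc N) cs) f ≡ ∑[ a ∈ cs ] ∑[ v ∈ allVecs N cs ] f (a ∷ v)
  ∑-allVecs-suc N cs f = trans (∑-concatMap (λ a → map (a ∷_) (allVecs N cs)) cs f)
                               (∑-cong (λ a → ∑-map (a ∷_) (allVecs N cs) f) cs)

  ∑-allVecs-++ : ∀ m n (cs : List A) {f : Vec A (m + n) → ℕ} {g : Vec A m → ℕ} {h : Vec A n → ℕ} →
                 (∀ xs ys → f (xs Vec.++ ys) ≡ g xs * h ys) →
                 ∑ (allVecs (m + n) cs) f ≡ ∑ (allVecs m cs) g * ∑ (allVecs n cs) h
  ∑-allVecs-++ zero    n cs {f} {g} {h} f≡g*h = begin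
    ∑ (allVecs n cs) f            ≡⟨ ∑-cong (f≡g*h []) (allVecs n cs) ⟩
    ∑[ v ∈ allVecs n cs ] g [] * h v ≡⟨ ∑-*ˡ (g []) (allVecs n cs) h ⟩
    g [] * ∑ (allVecs n cs) h      ≡⟨ cong (_* ∑ (allVecs n cs) h) (sym (+-identityʳ (g []))) ⟩
    (g [] + 0) * ∑ (allVecs n cs) h ∎
    where open ≡-Reasoning
  ∑-allVecs-++ (suc m) n cs {f} {g} {h} f≡g*h = begin
    ∑ (allVecs (suc (m + n)) cs) f
      ≡⟨ ∑-allVecs-suc (m + n) cs f ⟩
    ∑[ a ∈ cs ] ∑[ v ∈ allVecs (m + n) cs ] f (a ∷ v)
      ≡⟨ ∑-cong (λ a → ∑-allVecs-++ m n cs (λ xs ys → f≡g*h (a ∷ xs) ys)) cs ⟩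
    ∑[ a ∈ cs ] (∑[ v ∈ allVecs m cs ] g (a ∷ v)) * ∑ (allVecs n cs) h
      ≡⟨ ∑-*ʳ (∑ (allVecs n cs) h) cs _ ⟩
    (∑[ a ∈ cs ] ∑[ v ∈ allVecs m cs ] g (a ∷ v)) * ∑ (allVecs n cs) h
      ≡⟨ cong (_* ∑ (allVecs n cs) h) (sym (∑-allVecs-suc m cs g)) ⟩
    ∑ (allVecs (suc m) cs) g * ∑ (allVecs n cs) h ∎
    where open ≡-Reasoning

  page : ∀ N {s} → Vec A (N * s) → Fin N → Vec A s
  page N w i = tabulate (λ j → Vec.lookup w (combine i j))

  page-++-zero : ∀ {N s} (xs : Vec A s) (ys : Vec A (N * s)) → page (suc N) (xs Vec.++ ys) fz ≡ xs
  page-++-zero xs ys = trans (tabulate-cong (lookup-++ˡ xs ys)) (tabulate∘lookup xs)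

  page-++-suc : ∀ {N s} (xs : Vec A s) (ys : Vec A (N * s)) i → page (suc N) (xs Vec.++ ys) (fs i) ≡ page N ys i
  page-++-suc xs ys i = tabulate-cong (λ j → lookup-++ʳ xs ys (combine i j))

  module _ {s : ℕ} (P : Vec A s → Set) where

    AllPages : ∀ N → Vec A (N * s) → Set
    AllPages N w = ∀ i → P (page N w i)

    allPages? : (∀ v → Dec (P v)) → ∀ N (w : Vec A (N * s)) → Dec (AllPages N w)
    allPages? P? N w = Fin.all? (λ i → P? (page N w i))

    allPages-++ : ∀ {N} (xs : Vec A s) (ys : Vec A (N * s)) → AllPages (suc N) (xs Vec.++ ys) ⇔ (P xs × AllPages N ys)
    allPages-++ {N} xs ys = mk⇔
      (λ all → subst P (page-++-zero {N = N} xs ys) (all fz) , λ i → subst P (page-++-suc {N = N} xs ys i) (all (fs i)))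
      (λ { (Pxs , _) fz → subst P (sym (page-++-zero {N = N} xs ys)) Pxs
         ; (_ , allys) (fs i) → subst P (sym (page-++-suc {N = N} xs ys i)) (allys i) })

    ∑-allPages : (cs : List A) (P? : ∀ v → Dec (P v)) (N : ℕ) →
                 ∑[ w ∈ allVecs (N * s) cs ] 𝟙 (allPages? P? N w) ≡ (∑[ v ∈ allVecs s cs ] 𝟙 (P? v)) ^ N
    ∑-allPages cs P? zero    = refl
    ∑-allPages cs P? (suc N) = trans
      (∑-allVecs-++ s (N * s) cs λ xs ys → trans
        (𝟙-⇔ (allPages-++ xs ys) (allPages? P? (suc N) (xs Vec.++ ys)) (P? xs ×-dec allPages? P? N ys))
        (𝟙-× (P? xs) (allPages? P? N ys)))
      (cong ((∑[ v ∈ allVecs s cs ] 𝟙 (P? v)) *_) (∑-allPages cs P? N))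

  -- Proper colourings of the r interior vertices of a path in t + 2 colours whose two end
  -- colours are fixed and equal, resp. distinct.
  mutual
    equalEnds : ℕ → ℕ → ℕ
    equalEnds t zero    = 0
    equalEnds t (suc r) = suc t * distinctEnds t r

    distinctEnds : ℕ → ℕ → ℕ
    distinctEnds t zero    = 1
    distinctEnds t (suc r) = equalEnds t r + t * distinctEnds t r

  d+x≡e+[1+t]d⇒x≡e+td : ∀ d x e t → d + x ≡ e + suc t * d → x ≡ e + t * d
  d+x≡e+[1+t]d⇒x≡e+td d x e t eq = +-cancelˡ-≡ d x (e + t * d) (trans eq (shift e d t))
    where
    shift : ∀ e d t → e + suc t * d ≡ d + (e + t * d)
    shift = solve-∀

  module PathColourings {A : Set} (_≟_ : DecidableEquality A) (cs : List A) where

    ProperPath : ∀ {r} → A → A → Vec A r → Set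
    ProperPath a b []      = a ≢ b
    ProperPath a b (x ∷ w) = a ≢ x × ProperPath x b w

    properPath? : ∀ {r} a b (w : Vec A r) → Dec (ProperPath a b w)
    properPath? a b []      = ¬? (a ≟ b)
    properPath? a b (x ∷ w) = ¬? (a ≟ x) ×-dec properPath? x b w

    PathEdges : ∀ {p} → A → A → (Fin (suc p) → A) → Set
    PathEdges {p} a b f = a ≢ f fz × f (fromℕ p) ≢ b × (∀ j → f (inject₁ j) ≢ f (fs j))

    properPath⇔pathEdges : ∀ {p} a b (f : Fin (suc p) → A) → ProperPath a b (tabulate f) ⇔ PathEdges a b f
    properPath⇔pathEdges {zero}  a b f = mk⇔ (λ (a≢f₀ , f₀≢b) → a≢f₀ , f₀≢b , λ ())
                                            (λ (a≢f₀ , f₀≢b , _) → a≢f₀ , f₀≢b)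
    properPath⇔pathEdges {suc p} a b f = mk⇔
      (λ (a≢f₀ , rest) → let (f₀≢f₁ , last≢b , inner) = Equivalence.to tail rest
                         in a≢f₀ , last≢b , λ { fz → f₀≢f₁ ; (fs j) → inner j })
      (λ (a≢f₀ , last≢b , inner) → a≢f₀ , Equivalence.from tail (inner fz , last≢b , inner ∘ fs))
      where
      tail : ProperPath (f fz) b (tabulate (f ∘ fs)) ⇔ PathEdges (f fz) b (f ∘ fs)
      tail = properPath⇔pathEdges (f fz) b (f ∘ fs)

    ∑-except : A → (A → ℕ) → ℕ
    ∑-except a f = ∑[ x ∈ cs ] 𝟙 (¬? (a ≟ x)) * f x

    ∑-except-cong : ∀ a {f g : A → ℕ} → (∀ x → a ≢ x → f x ≡ g x) → ∑-except a f ≡ ∑-except a g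
    ∑-except-cong a {f} {g} f≗g = ∑-cong pointwise cs
      where
      pointwise : ∀ x → 𝟙 (¬? (a ≟ x)) * f x ≡ 𝟙 (¬? (a ≟ x)) * g x
      pointwise x with a ≟ x
      ... | yes _   = refl
      ... | no  a≢x = cong (_+ 0) (f≗g x a≢x)

    pathColourings : ℕ → A → A → ℕ
    pathColourings zero    a b = 𝟙 (¬? (a ≟ b))
    pathColourings (suc r) a b = ∑-except a (λ x → pathColourings r x b)

    ∑-properPath : ∀ r a b → ∑[ w ∈ allVecs r cs ] 𝟙 (properPath? a b w) ≡ pathColourings r a b
    ∑-properPath zero    a b = +-identityʳ _
    ∑-properPath (suc r) a b = trans (∑-allVecs-suc r cs _) (∑-cong interior cs)
      where
      interior : ∀ x → ∑[ w ∈ allVecs r cs ] 𝟙 (properPath? a b (x ∷ w))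
                       ≡ 𝟙 (¬? (a ≟ x)) * pathColourings r x b
      interior x = begin
        ∑[ w ∈ allVecs r cs ] 𝟙 (properPath? a b (x ∷ w))
          ≡⟨ ∑-cong (λ w → 𝟙-× (¬? (a ≟ x)) (properPath? x b w)) (allVecs r cs) ⟩
        ∑[ w ∈ allVecs r cs ] 𝟙 (¬? (a ≟ x)) * 𝟙 (properPath? x b w)
          ≡⟨ ∑-*ˡ (𝟙 (¬? (a ≟ x))) (allVecs r cs) _ ⟩
        𝟙 (¬? (a ≟ x)) * (∑[ w ∈ allVecs r cs ] 𝟙 (properPath? x b w))
          ≡⟨ cong (𝟙 (¬? (a ≟ x)) *_) (∑-properPath r x b) ⟩
        𝟙 (¬? (a ≟ x)) * pathColourings r x b ∎
        where open ≡-Reasoning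

    module _ (cs-unique : Unique cs) (cs-complete : ∀ a → a ∈ cs) where

      ∑-split : ∀ a (f : A → ℕ) → ∑ cs f ≡ f a + ∑-except a f
      ∑-split a f = begin
        ∑ cs f
          ≡⟨ ∑-cong (λ x → sym (𝟙-+-𝟙¬ (a ≟ x) (f x))) cs ⟩
        ∑[ x ∈ cs ] (𝟙 (a ≟ x) * f x + 𝟙 (¬? (a ≟ x)) * f x)
          ≡⟨ ∑-+ cs _ _ ⟩
        (∑[ x ∈ cs ] 𝟙 (a ≟ x) * f x) + ∑-except a f
          ≡⟨ cong (_+ ∑-except a f) (∑-cong at-a cs) ⟩
        (∑[ x ∈ cs ] 𝟙 (a ≟ x) * f a) + ∑-except a f
          ≡⟨ cong (_+ ∑-except a f) (∑-*ʳ (f a) cs _) ⟩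
        (∑[ x ∈ cs ] 𝟙 (a ≟ x)) * f a + ∑-except a f
          ≡⟨ cong (λ n → n * f a + ∑-except a f) (∑-𝟙≟-unique _≟_ cs-unique (cs-complete a)) ⟩
        1 * f a + ∑-except a f
          ≡⟨ cong (_+ ∑-except a f) (*-identityˡ (f a)) ⟩
        f a + ∑-except a f ∎
        where
        open ≡-Reasoning
        at-a : ∀ x → 𝟙 (a ≟ x) * f x ≡ 𝟙 (a ≟ x) * f a
        at-a x with a ≟ x
        ... | yes refl = refl
        ... | no  _    = refl

      module _ (t : ℕ) (cs-length : length cs ≡ 2 + t) where

        ∑-except-const : ∀ a d → ∑-except a (λ _ → d) ≡ suc t * d
        ∑-except-const a d = +-cancelˡ-≡ d _ _ (begin
          d + ∑-except a (λ _ → d) ≡⟨ ∑-split a (λ _ → d) ⟨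
          ∑[ _ ∈ cs ] d            ≡⟨ ∑-const d cs ⟩
          length cs * d            ≡⟨ cong (_* d) cs-length ⟩
          d + suc t * d            ∎)
          where open ≡-Reasoning

        ∑-spike : ∀ a {f : A → ℕ} {s d} → f a ≡ s → (∀ x → a ≢ x → f x ≡ d) → ∑ cs f ≡ s + suc t * d
        ∑-spike a {f} {s} {d} fa≡s f≡d = begin
          ∑ cs f                   ≡⟨ ∑-split a f ⟩
          f a + ∑-except a f       ≡⟨ cong₂ _+_ fa≡s (∑-except-cong a f≡d) ⟩
          s + ∑-except a (λ _ → d) ≡⟨ cong (s +_) (∑-except-const a d) ⟩
          s + suc t * d            ∎
          where open ≡-Reasoning

        pathColourings-ends : ∀ r a b → (a ≡ b → pathColourings r a b ≡ equalEnds t r)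
                                       × (a ≢ b → pathColourings r a b ≡ distinctEnds t r)
        pathColourings-ends zero a b = (λ a≡b → 𝟙-no (λ a≢b → a≢b a≡b) (¬? (a ≟ b))) , (λ a≢b → 𝟙-yes a≢b (¬? (a ≟ b)))
        pathColourings-ends (suc r) a b = equal , distinct
          where
          total : pathColourings r a b + pathColourings (suc r) a b ≡ equalEnds t r + suc t * distinctEnds t r
          total = trans (sym (∑-split a (λ x → pathColourings r x b)))
                        (∑-spike b (proj₁ (pathColourings-ends r b b) refl)
                                   (λ x b≢x → proj₂ (pathColourings-ends r x b) (b≢x ∘ sym)))
          equal : a ≡ b → pathColourings (suc r) a b ≡ equalEnds t (suc r)
          equal refl = +-cancelˡ-≡ (equalEnds t r) _ _ (trans (cong (_+ _) (sym (proj₁ (pathColourings-ends r a a) refl))) total)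
          distinct : a ≢ b → pathColourings (suc r) a b ≡ distinctEnds t (suc r)
          distinct a≢b = d+x≡e+[1+t]d⇒x≡e+td (distinctEnds t r) _ (equalEnds t r) t
            (trans (cong (_+ _) (sym (proj₂ (pathColourings-ends r a b) a≢b))) total)

        pathColourings-equal : ∀ r a → pathColourings r a a ≡ equalEnds t r
        pathColourings-equal r a = proj₁ (pathColourings-ends r a a) refl

        pathColourings-distinct : ∀ r {a b} → a ≢ b → pathColourings r a b ≡ distinctEnds t r
        pathColourings-distinct r {a} {b} = proj₂ (pathColourings-ends r a b)

        ∑-except-pathColourings^ : ∀ r N {a c} → a ≢ c →
          ∑-except c (λ b → pathColourings r a b ^ N) ≡ equalEnds t r ^ N + t * distinctEnds t r ^ N
        ∑-except-pathColourings^ r N {a} {c} a≢c = d+x≡e+[1+t]d⇒x≡e+td (distinctEnds t r ^ N) _ _ t (begin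
          distinctEnds t r ^ N + ∑-except c F
            ≡⟨ cong (λ n → n ^ N + ∑-except c F) (pathColourings-distinct r a≢c) ⟨
          F c + ∑-except c F
            ≡⟨ ∑-split c F ⟨
          ∑ cs F
            ≡⟨ ∑-spike a (cong (_^ N) (pathColourings-equal r a)) (λ b a≢b → cong (_^ N) (pathColourings-distinct r a≢b)) ⟩
          equalEnds t r ^ N + suc t * distinctEnds t r ^ N ∎)
          where
          open ≡-Reasoning
          F : A → ℕ
          F b = pathColourings r a b ^ N

        ∑∑-except-pathColourings^ : (ν : A → A) → (∀ a → a ≢ ν a) → ∀ r N →
          ∑[ a ∈ cs ] ∑-except (ν a) (λ b → pathColourings r a b ^ N)
          ≡ (2 + t) * (equalEnds t r ^ N + t * distinctEnds t r ^ N)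
        ∑∑-except-pathColourings^ ν a≢νa r N = begin
          ∑[ a ∈ cs ] ∑-except (ν a) (λ b → pathColourings r a b ^ N)
            ≡⟨ ∑-cong (λ a → ∑-except-pathColourings^ r N (a≢νa a)) cs ⟩
          ∑[ a ∈ cs ] (equalEnds t r ^ N + t * distinctEnds t r ^ N)
            ≡⟨ ∑-const _ cs ⟩
          length cs * (equalEnds t r ^ N + t * distinctEnds t r ^ N)
            ≡⟨ cong (_* _) cs-length ⟩
          (2 + t) * (equalEnds t r ^ N + t * distinctEnds t r ^ N) ∎
          where open ≡-Reasoning

  module BookColourings (k : ℕ) where
    open import Defs using (Colour; value; allColours; Edge; BV; Proper; proper?; bookEdges; χbook; _·_)
    open import Data.Integer as ℤ using (ℤ)
    import Data.Integer.Properties as ℤ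
    open import Data.Sign as Sign using (Sign)
    import Data.Sign.Properties as Sign
    open import Data.Product.Properties using (≡-dec)
    open import Data.Nat.Properties using (suc-injective)
    open import Data.List using (allFin)
    open import Data.List.Properties using (length-++; length-map; length-tabulate)
    open import Data.List.Membership.Propositional.Properties using (∈-cartesianProduct⁺; ∈-allFin)
    open import Data.List.Relation.Unary.Unique.Propositional.Properties using (cartesianProduct⁺; allFin⁺)
    import Data.List.Relation.Unary.All.Properties as All

    _≟_ : DecidableEquality (Colour k)
    _≟_ = ≡-dec Sign._≟_ Fin._≟_

    colours-unique : Unique (allColours k)
    colours-unique = cartesianProduct⁺ (((λ ()) ∷ []) ∷ [] ∷ []) (allFin⁺ k)

    colours-complete : ∀ c → c ∈ allColours k
    colours-complete (Sign.+ , i) = ∈-cartesianProduct⁺ {xs = Sign.+ ∷ Sign.- ∷ []} (here refl) (∈-allFin i)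
    colours-complete (Sign.- , i) = ∈-cartesianProduct⁺ {xs = Sign.+ ∷ Sign.- ∷ []} (there (here refl)) (∈-allFin i)

    colours-length : length (allColours k) ≡ 2 * k
    colours-length = trans (length-++ (signed Sign.+) {signed Sign.- ++ []})
      (cong₂ _+_ (length-signed Sign.+) (trans (length-++ (signed Sign.-) {[]}) (cong (_+ 0) (length-signed Sign.-))))
      where
      signed : Sign → List (Colour k)
      signed s = map (λ i → (s , i)) (allFin k)
      length-signed : ∀ s → length (signed s) ≡ k
      length-signed s = trans (length-map (λ i → (s , i)) (allFin k)) (length-tabulate id)

    neg : Colour k → Colour k
    neg (s , i) = Sign.opposite s , i

    c≢neg-c : ∀ c → c ≢ neg c
    c≢neg-c (Sign.+ , _) ()
    c≢neg-c (Sign.- , _) ()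

    value-neg : ∀ c → value (neg c) ≡ ℤ.- value c
    value-neg (Sign.+ , _) = refl
    value-neg (Sign.- , _) = refl

    value-injective : ∀ {c d : Colour k} → value c ≡ value d → c ≡ d
    value-injective {Sign.+ , i} {Sign.+ , j} eq = cong (Sign.+ ,_) (Fin.toℕ-injective (suc-injective (ℤ.+-injective eq)))
    value-injective {Sign.- , i} {Sign.- , j} eq = cong (Sign.- ,_) (Fin.toℕ-injective (ℤ.-[1+-injective eq))
    value-injective {Sign.+ , _} {Sign.- , _} ()
    value-injective {Sign.- , _} {Sign.+ , _} ()

    positiveEdge⇔ : ∀ {c d : Colour k} → value c ≢ Sign.+ · value d ⇔ c ≢ d
    positiveEdge⇔ = mk⇔ (λ ne eq → ne (cong value eq)) (λ ne eq → ne (value-injective eq))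

    negativeEdge⇔ : ∀ {c d : Colour k} → value c ≢ Sign.- · value d ⇔ neg c ≢ d
    negativeEdge⇔ {c} {d} = mk⇔
      (λ ne eq → ne (sym (trans (cong ℤ.-_ (trans (sym (cong value eq)) (value-neg c))) (ℤ.neg-involutive (value c)))))
      (λ ne eq → ne (value-injective (trans (value-neg c) (trans (cong ℤ.-_ eq) (ℤ.neg-involutive (value d))))))

    open PathColourings _≟_ (allColours k)

    properBook⇔ : ∀ p N a b (w : Vec (Colour k) (N * suc p)) →
                  Proper (bookEdges (3 + p) N) (a ∷ b ∷ w) ⇔ (neg a ≢ b × AllPages (ProperPath a b) N w)
    properBook⇔ p N a b w = mk⇔ to from
      where
      pathEdges⇔ : ∀ i → ProperPath a b (page N w i) ⇔ PathEdges a b (λ j → Vec.lookup w (combine i j))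
      pathEdges⇔ i = properPath⇔pathEdges a b (λ j → Vec.lookup w (combine i j))

      to : Proper (bookEdges (3 + p) N) (a ∷ b ∷ w) → neg a ≢ b × AllPages (ProperPath a b) N w
      to (uv ∷ pages) = Equivalence.to negativeEdge⇔ uv , λ i →
        case All.tabulate⁻ (All.map⁻ (All.concat⁻ pages)) i of λ { (first ∷ last ∷ inner) →
          Equivalence.from (pathEdges⇔ i)
            ( Equivalence.to positiveEdge⇔ first
            , Equivalence.to positiveEdge⇔ last
            , λ j → Equivalence.to positiveEdge⇔ (All.tabulate⁻ (All.map⁻ inner) j)) }

      from : neg a ≢ b × AllPages (ProperPath a b) N w → Proper (bookEdges (3 + p) N) (a ∷ b ∷ w)
      from (neg-a≢b , pages) = Equivalence.from negativeEdge⇔ neg-a≢b ∷ All.concat⁺ (All.map⁺ (All.tabulate⁺ λ i →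
        let (a≢first , last≢b , inner) = Equivalence.to (pathEdges⇔ i) (pages i)
        in Equivalence.from positiveEdge⇔ a≢first ∷ Equivalence.from positiveEdge⇔ last≢b
           ∷ All.map⁺ (All.tabulate⁺ λ j → Equivalence.from positiveEdge⇔ (inner j))))

    χbook≡ : ∀ p N t → 2 * k ≡ 2 + t →
             χbook (3 + p) N k ≡ 2 * k * (equalEnds t (suc p) ^ N + t * distinctEnds t (suc p) ^ N)
    χbook≡ p N t 2k≡2+t = begin
      χbook (3 + p) N k
        ≡⟨ length-filter (proper? E) (allVecs (2 + N * suc p) cs) ⟩
      ∑[ c ∈ allVecs (2 + N * suc p) cs ] 𝟙 (proper? E c)
        ≡⟨ ∑-allVecs-suc (1 + N * suc p) cs _ ⟩
      ∑[ a ∈ cs ] ∑[ v ∈ allVecs (1 + N * suc p) cs ] 𝟙 (proper? E (a ∷ v))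
        ≡⟨ ∑-cong (λ a → ∑-allVecs-suc (N * suc p) cs _) cs ⟩
      ∑[ a ∈ cs ] ∑[ b ∈ cs ] ∑[ w ∈ allVecs (N * suc p) cs ] 𝟙 (proper? E (a ∷ b ∷ w))
        ≡⟨ ∑-cong (λ a → ∑-cong (λ b → interiors a b) cs) cs ⟩
      ∑[ a ∈ cs ] ∑-except (neg a) (λ b → pathColourings (suc p) a b ^ N)
        ≡⟨ ∑∑-except-pathColourings^ colours-unique colours-complete t (trans colours-length 2k≡2+t) neg c≢neg-c (suc p) N ⟩
      (2 + t) * (equalEnds t (suc p) ^ N + t * distinctEnds t (suc p) ^ N)
        ≡⟨ cong (_* (equalEnds t (suc p) ^ N + t * distinctEnds t (suc p) ^ N)) 2k≡2+t ⟨
      2 * k * (equalEnds t (suc p) ^ N + t * distinctEnds t (suc p) ^ N) ∎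
      where
      open ≡-Reasoning
      cs : List (Colour k)
      cs = allColours k
      E : List (Edge (BV (3 + p) N))
      E = bookEdges (3 + p) N
      interiors : ∀ a b → ∑[ w ∈ allVecs (N * suc p) cs ] 𝟙 (proper? E (a ∷ b ∷ w))
                      ≡ 𝟙 (¬? (neg a ≟ b)) * pathColourings (suc p) a b ^ N
      interiors a b = begin
        ∑[ w ∈ allVecs (N * suc p) cs ] 𝟙 (proper? E (a ∷ b ∷ w))
          ≡⟨ ∑-cong (λ w → 𝟙-⇔ (properBook⇔ p N a b w) (proper? E (a ∷ b ∷ w)) (¬? (neg a ≟ b) ×-dec pages? w)) (allVecs (N * suc p) cs) ⟩
        ∑[ w ∈ allVecs (N * suc p) cs ] 𝟙 (¬? (neg a ≟ b) ×-dec pages? w)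
          ≡⟨ ∑-cong (λ w → 𝟙-× (¬? (neg a ≟ b)) (pages? w)) (allVecs (N * suc p) cs) ⟩
        ∑[ w ∈ allVecs (N * suc p) cs ] 𝟙 (¬? (neg a ≟ b)) * 𝟙 (pages? w)
          ≡⟨ ∑-*ˡ (𝟙 (¬? (neg a ≟ b))) (allVecs (N * suc p) cs) (𝟙 ∘ pages?) ⟩
        𝟙 (¬? (neg a ≟ b)) * (∑[ w ∈ allVecs (N * suc p) cs ] 𝟙 (pages? w))
          ≡⟨ cong (𝟙 (¬? (neg a ≟ b)) *_) (∑-allPages (ProperPath a b) cs (properPath? a b) N) ⟩
        𝟙 (¬? (neg a ≟ b)) * (∑[ v ∈ allVecs (suc p) cs ] 𝟙 (properPath? a b v)) ^ N
          ≡⟨ cong (λ n → 𝟙 (¬? (neg a ≟ b)) * n ^ N) (∑-properPath (suc p) a b) ⟩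
        𝟙 (¬? (neg a ≟ b)) * pathColourings (suc p) a b ^ N ∎
        where
        pages? : (w : Vec (Colour k) (N * suc p)) → Dec (AllPages (ProperPath a b) N w)
        pages? = allPages? (ProperPath a b) (properPath? a b) N

module Rationals where
  open ColouringCounts using (equalEnds; distinctEnds; module BookColourings)
  open import Defs using (ℕtoℚ; twice; χbook; _^_; _/'_; γ)
  open import Data.Nat.Properties using (*-suc)
  open import Data.Nat as ℕ using (ℕ; zero; suc)
  import Data.Integer as ℤ
  import Data.Integer.Properties as ℤ
  open import Data.Rational using (ℚ; _/_; _+_; _*_; _-_; -_; 0ℚ; 1ℚ; mkℚ; 1/_; NonZero; ≢-nonZero)
  import Data.Rational.Properties as ℚ
  open import Data.Rational.Solver using (module +-*-Solver)
  open +-*-Solver using (solve; _:+_; _:*_; _:-_; :-_; _:=_; con)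
  import Data.Nat.Coprimality as Coprime
  open import Relation.Binary.PropositionalEquality
  open import Relation.Nullary using (yes; no)
  open import Data.Empty using (⊥-elim)

  ℕtoℚ≡mkℚ : ∀ n → ℕtoℚ n ≡ mkℚ (ℤ.+ n) 0 (Coprime.sym (Coprime.1-coprimeTo n))
  ℕtoℚ≡mkℚ n = ℚ.normalize-coprime (Coprime.sym (Coprime.1-coprimeTo n))

  ℕtoℚ-+ : ∀ m n → ℕtoℚ (m ℕ.+ n) ≡ ℕtoℚ m + ℕtoℚ n
  ℕtoℚ-+ m n rewrite ℕtoℚ≡mkℚ m | ℕtoℚ≡mkℚ n =
    cong (_/ 1) (cong₂ ℤ._+_ (sym (ℤ.*-identityʳ (ℤ.+ m))) (sym (ℤ.*-identityʳ (ℤ.+ n))))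

  ℕtoℚ-* : ∀ m n → ℕtoℚ (m ℕ.* n) ≡ ℕtoℚ m * ℕtoℚ n
  ℕtoℚ-* m n rewrite ℕtoℚ≡mkℚ m | ℕtoℚ≡mkℚ n = cong (_/ 1) (ℤ.pos-* m n)

  ℕtoℚ-suc : ∀ n → ℕtoℚ (suc n) ≡ 1ℚ + ℕtoℚ n
  ℕtoℚ-suc = ℕtoℚ-+ 1

  ℕtoℚ-^ : ∀ m n → ℕtoℚ (m ℕ.^ n) ≡ ℕtoℚ m ^ n
  ℕtoℚ-^ m zero    = refl
  ℕtoℚ-^ m (suc n) = trans (ℕtoℚ-* m (m ℕ.^ n)) (cong (ℕtoℚ m *_) (ℕtoℚ-^ m n))

  ℕtoℚ-suc≢0 : ∀ n → ℕtoℚ (suc n) ≢ 0ℚ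
  ℕtoℚ-suc≢0 n eq with trans (sym (ℕtoℚ≡mkℚ (suc n))) eq
  ... | ()

  ^-distrib-* : ∀ x y n → (x * y) ^ n ≡ x ^ n * y ^ n
  ^-distrib-* x y zero    = refl
  ^-distrib-* x y (suc n) = trans (cong ((x * y) *_) (^-distrib-* x y n))
    (solve 4 (λ x y xⁿ yⁿ → (x :* y) :* (xⁿ :* yⁿ) := (x :* xⁿ) :* (y :* yⁿ)) refl x y (x ^ n) (y ^ n))

  *-/'-cancelˡ : ∀ x z → x ≢ 0ℚ → (x * z) /' x ≡ z
  *-/'-cancelˡ x z x≢0 with x ℚ.≟ 0ℚ
  ... | yes x≡0 = ⊥-elim (x≢0 x≡0)
  ... | no  x≢0 = begin
    x * z * 1/ x   ≡⟨ cong (_* 1/ x) (ℚ.*-comm x z) ⟩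
    z * x * 1/ x   ≡⟨ ℚ.*-assoc z x (1/ x) ⟩
    z * (x * 1/ x) ≡⟨ cong (z *_) (ℚ.*-inverseʳ x) ⟩
    z * 1ℚ         ≡⟨ ℚ.*-identityʳ z ⟩
    z              ∎
    where
    open ≡-Reasoning
    instance
      x-nonZero : NonZero x
      x-nonZero = ≢-nonZero x≢0

  /'-selfInverse : ∀ y q → q * q ≡ 1ℚ → y /' q ≡ y * q
  /'-selfInverse y q q²≡1 with q ℚ.≟ 0ℚ
  ... | yes refl = ⊥-elim (ℚ.1≢0 (sym q²≡1))
  ... | no  q≢0  = cong (y *_) (begin
    1/ q             ≡⟨ ℚ.*-identityˡ (1/ q) ⟨
    1ℚ * 1/ q        ≡⟨ cong (_* 1/ q) q²≡1 ⟨
    q * q * 1/ q     ≡⟨ ℚ.*-assoc q q (1/ q) ⟩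
    q * (q * 1/ q)   ≡⟨ cong (q *_) (ℚ.*-inverseʳ q) ⟩
    q * 1ℚ           ≡⟨ ℚ.*-identityʳ q ⟩
    q                ∎)
    where
    open ≡-Reasoning
    instance
      q-nonZero : NonZero q
      q-nonZero = ≢-nonZero q≢0

  sign² : ∀ j → (- 1ℚ) ^ j * (- 1ℚ) ^ j ≡ 1ℚ
  sign² zero    = refl
  sign² (suc j) = trans (solve 1 (λ s → ((:- con 1ℚ) :* s) :* ((:- con 1ℚ) :* s) := s :* s) refl ((- 1ℚ) ^ j)) (sign² j)

  bookPolynomial : ℚ → ℚ → ℚ → ℕ → ℚ
  bookPolynomial Λ a b N = Λ * (((Λ - 1ℚ) * a) ^ N + (Λ - 1ℚ - 1ℚ) * b ^ N)

  bookPolynomial-suc : ∀ {Λ a b e} N → b ≡ (Λ - 1ℚ) * a + e →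
    bookPolynomial Λ a b (suc N) ≡ (Λ - 1ℚ) * a * bookPolynomial Λ a b N + e * Λ * (Λ - 1ℚ - 1ℚ) * b ^ N
  bookPolynomial-suc {Λ} {a} {_} {e} N refl =
    solve 5 (λ L a e X Y → let b = (L :- con 1ℚ) :* a :+ e in
               L :* ((L :- con 1ℚ) :* a :* X :+ (L :- con 1ℚ :- con 1ℚ) :* (b :* Y))
            := (L :- con 1ℚ) :* a :* (L :* (X :+ (L :- con 1ℚ :- con 1ℚ) :* Y)) :+ e :* L :* (L :- con 1ℚ :- con 1ℚ) :* Y)
      refl Λ a e (((Λ - 1ℚ) * a) ^ N) (((Λ - 1ℚ) * a + e) ^ N)

  bookPolynomial-closedForm : ∀ {Λ a b c e} N → b ≡ (Λ - 1ℚ) * a + e → c ≡ (Λ - 1ℚ) * a + (Λ - 1ℚ - 1ℚ) * b →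
    e * e ≡ 1ℚ →
    bookPolynomial Λ a b (suc N)
    ≡ Λ * (Λ - 1ℚ) ^ N * a ^ N * c
      + e * Λ * (Λ - 1ℚ - 1ℚ) * b * (((Λ - 1ℚ) ^ N * a ^ N - b ^ N) /' ((Λ - 1ℚ) * a - b))
  -- The divisor is −e, so dividing by it is multiplying by it.
  bookPolynomial-closedForm {Λ} {a} {b} {c} {e} N refl refl e²≡1 = begin
    Λ * ((Λ - 1ℚ) * a * ((Λ - 1ℚ) * a) ^ N + (Λ - 1ℚ - 1ℚ) * (b * Y))
      ≡⟨ cong (λ X → Λ * ((Λ - 1ℚ) * a * X + (Λ - 1ℚ - 1ℚ) * (b * Y))) (^-distrib-* (Λ - 1ℚ) a N) ⟩
    Λ * ((Λ - 1ℚ) * a * (P * A) + (Λ - 1ℚ - 1ℚ) * (b * Y))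
      ≡⟨ solve 6 (λ L a e P A Y → let b = (L :- con 1ℚ) :* a :+ e ; c = (L :- con 1ℚ) :* a :+ (L :- con 1ℚ :- con 1ℚ) :* b in
               L :* ((L :- con 1ℚ) :* a :* (P :* A) :+ (L :- con 1ℚ :- con 1ℚ) :* (b :* Y))
            := L :* P :* A :* c :+ e :* L :* (L :- con 1ℚ :- con 1ℚ) :* b :* ((P :* A :- Y) :* ((L :- con 1ℚ) :* a :- b))
               :+ L :* (L :- con 1ℚ :- con 1ℚ) :* b :* (P :* A :- Y) :* (e :* e :- con 1ℚ))
          refl Λ a e P A Y ⟩
    R + Λ * (Λ - 1ℚ - 1ℚ) * b * (P * A - Y) * (e * e - 1ℚ)
      ≡⟨ cong (λ z → R + Λ * (Λ - 1ℚ - 1ℚ) * b * (P * A - Y) * (z - 1ℚ)) e²≡1 ⟩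
    R + Λ * (Λ - 1ℚ - 1ℚ) * b * (P * A - Y) * (1ℚ - 1ℚ)
      ≡⟨ solve 2 (λ R Z → R :+ Z :* (con 1ℚ :- con 1ℚ) := R) refl R (Λ * (Λ - 1ℚ - 1ℚ) * b * (P * A - Y)) ⟩
    R
      ≡⟨ cong (λ z → Λ * P * A * c + e * Λ * (Λ - 1ℚ - 1ℚ) * b * z) (/'-selfInverse (P * A - Y) _ divisor²≡1) ⟨
    Λ * P * A * c + e * Λ * (Λ - 1ℚ - 1ℚ) * b * ((P * A - Y) /' ((Λ - 1ℚ) * a - b)) ∎
    where
    open ≡-Reasoning
    P A Y R : ℚ
    P = (Λ - 1ℚ) ^ N
    A = a ^ N
    Y = b ^ N
    R = Λ * P * A * c + e * Λ * (Λ - 1ℚ - 1ℚ) * b * ((P * A - Y) * ((Λ - 1ℚ) * a - b))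
    divisor²≡1 : ((Λ - 1ℚ) * a - b) * ((Λ - 1ℚ) * a - b) ≡ 1ℚ
    divisor²≡1 = trans (solve 3 (λ L a e → let d = (L :- con 1ℚ) :* a :- ((L :- con 1ℚ) :* a :+ e) in d :* d := e :* e) refl Λ a e) e²≡1

  module PathCounts (q t : ℕ) (q≡2+t : q ≡ 2 ℕ.+ t) where

    Λ : ℚ
    Λ = ℕtoℚ q

    E D : ℕ → ℚ
    E r = ℕtoℚ (equalEnds t r)
    D r = ℕtoℚ (distinctEnds t r)

    Λ≢0 : Λ ≢ 0ℚ
    Λ≢0 rewrite q≡2+t = ℕtoℚ-suc≢0 (suc t)

    t≡Λ-2 : ℕtoℚ t ≡ Λ - 1ℚ - 1ℚ
    t≡Λ-2 = begin
      ℕtoℚ t                           ≡⟨ solve 1 (λ T → T := con 1ℚ :+ (con 1ℚ :+ T) :- con 1ℚ :- con 1ℚ) refl (ℕtoℚ t) ⟩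
      1ℚ + (1ℚ + ℕtoℚ t) - 1ℚ - 1ℚ     ≡⟨ cong (λ x → 1ℚ + x - 1ℚ - 1ℚ) (ℕtoℚ-suc t) ⟨
      1ℚ + ℕtoℚ (suc t) - 1ℚ - 1ℚ      ≡⟨ cong (λ x → x - 1ℚ - 1ℚ) (ℕtoℚ-suc (suc t)) ⟨
      ℕtoℚ (2 ℕ.+ t) - 1ℚ - 1ℚ         ≡⟨ cong (λ n → ℕtoℚ n - 1ℚ - 1ℚ) q≡2+t ⟨
      Λ - 1ℚ - 1ℚ                      ∎
      where open ≡-Reasoning

    equalEnds-suc : ∀ r → E (suc r) ≡ (Λ - 1ℚ) * D r
    equalEnds-suc r = trans (ℕtoℚ-* (suc t) (distinctEnds t r)) (cong (_* D r) (begin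
      ℕtoℚ (suc t)        ≡⟨ ℕtoℚ-suc t ⟩
      1ℚ + ℕtoℚ t         ≡⟨ cong (1ℚ +_) t≡Λ-2 ⟩
      1ℚ + (Λ - 1ℚ - 1ℚ)  ≡⟨ solve 1 (λ L → con 1ℚ :+ (L :- con 1ℚ :- con 1ℚ) := L :- con 1ℚ) refl Λ ⟩
      Λ - 1ℚ             ∎))
      where open ≡-Reasoning

    distinctEnds-suc : ∀ r → D (suc r) ≡ E r + (Λ - 1ℚ - 1ℚ) * D r
    distinctEnds-suc r = trans (ℕtoℚ-+ (equalEnds t r) _)
      (cong (E r +_) (trans (ℕtoℚ-* t (distinctEnds t r)) (cong (_* D r) t≡Λ-2)))

    distinct≡equal+sign : ∀ r → D r ≡ E r + (- 1ℚ) ^ r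
    distinct≡equal+sign zero    = refl
    distinct≡equal+sign (suc r) = begin
      D (suc r)                           ≡⟨ distinctEnds-suc r ⟩
      E r + (Λ - 1ℚ - 1ℚ) * D r           ≡⟨ cong (λ x → E r + (Λ - 1ℚ - 1ℚ) * x) (distinct≡equal+sign r) ⟩
      E r + (Λ - 1ℚ - 1ℚ) * (E r + s)     ≡⟨ solve 3 (λ L e s → e :+ (L :- con 1ℚ :- con 1ℚ) :* (e :+ s)
                                                        := (L :- con 1ℚ) :* (e :+ s) :+ (:- con 1ℚ) :* s) refl Λ (E r) s ⟩
      (Λ - 1ℚ) * (E r + s) + (- 1ℚ) * s   ≡⟨ cong (λ x → (Λ - 1ℚ) * x + (- 1ℚ) * s) (distinct≡equal+sign r) ⟨
      (Λ - 1ℚ) * D r + (- 1ℚ) * s         ≡⟨ cong (_+ (- 1ℚ) * s) (equalEnds-suc r) ⟨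
      E (suc r) + (- 1ℚ) ^ suc r          ∎
      where
      open ≡-Reasoning
      s : ℚ
      s = (- 1ℚ) ^ r

    distinctEnds-suc-sign : ∀ r → D (suc r) ≡ (Λ - 1ℚ) * D r + (- 1ℚ) ^ suc r
    distinctEnds-suc-sign r = trans (distinct≡equal+sign (suc r)) (cong (_+ (- 1ℚ) ^ suc r) (equalEnds-suc r))

    Λ*distinctEnds : ∀ r → Λ * D r ≡ (Λ - 1ℚ) ^ suc r - (- 1ℚ) ^ suc r
    Λ*distinctEnds zero    = solve 1 (λ L → L :* con 1ℚ := (L :- con 1ℚ) :* con 1ℚ :- (:- con 1ℚ) :* con 1ℚ) refl Λ
    Λ*distinctEnds (suc r) = begin
      Λ * D (suc r)                                  ≡⟨ cong (Λ *_) (distinctEnds-suc-sign r) ⟩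
      Λ * ((Λ - 1ℚ) * D r + (- 1ℚ) * s)              ≡⟨ solve 3 (λ L d s → L :* ((L :- con 1ℚ) :* d :+ (:- con 1ℚ) :* s)
                                                              := (L :- con 1ℚ) :* (L :* d) :- L :* s) refl Λ (D r) s ⟩
      (Λ - 1ℚ) * (Λ * D r) - Λ * s                    ≡⟨ cong (λ x → (Λ - 1ℚ) * x - Λ * s) (Λ*distinctEnds r) ⟩
      (Λ - 1ℚ) * ((Λ - 1ℚ) * P - (- 1ℚ) * s) - Λ * s  ≡⟨ solve 3 (λ L P s → (L :- con 1ℚ) :* ((L :- con 1ℚ) :* P :- (:- con 1ℚ) :* s) :- L :* s
                                                              := (L :- con 1ℚ) :* ((L :- con 1ℚ) :* P) :- (:- con 1ℚ) :* ((:- con 1ℚ) :* s)) refl Λ P s ⟩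
      (Λ - 1ℚ) ^ suc (suc r) - (- 1ℚ) ^ suc (suc r)  ∎
      where
      open ≡-Reasoning
      s P : ℚ
      s = (- 1ℚ) ^ r
      P = (Λ - 1ℚ) ^ r

    γ≡distinctEnds : ∀ r → γ (2 ℕ.+ r) Λ ≡ D r
    γ≡distinctEnds r = trans (cong (_/' Λ) (sym (Λ*distinctEnds r))) (*-/'-cancelˡ Λ (D r) Λ≢0)

    γ-suc : ∀ r → γ (3 ℕ.+ r) Λ ≡ (Λ - 1ℚ) * γ (2 ℕ.+ r) Λ + (- 1ℚ) ^ suc r
    γ-suc r = begin
      γ (3 ℕ.+ r) Λ                          ≡⟨ γ≡distinctEnds (suc r) ⟩
      D (suc r)                              ≡⟨ distinctEnds-suc-sign r ⟩
      (Λ - 1ℚ) * D r + (- 1ℚ) ^ suc r         ≡⟨ cong (λ x → (Λ - 1ℚ) * x + (- 1ℚ) ^ suc r) (γ≡distinctEnds r) ⟨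
      (Λ - 1ℚ) * γ (2 ℕ.+ r) Λ + (- 1ℚ) ^ suc r ∎
      where open ≡-Reasoning

    γ-suc-suc : ∀ r → γ (4 ℕ.+ r) Λ ≡ (Λ - 1ℚ) * γ (2 ℕ.+ r) Λ + (Λ - 1ℚ - 1ℚ) * γ (3 ℕ.+ r) Λ
    γ-suc-suc r = begin
      γ (4 ℕ.+ r) Λ                                ≡⟨ γ≡distinctEnds (2 ℕ.+ r) ⟩
      D (2 ℕ.+ r)                                  ≡⟨ distinctEnds-suc (suc r) ⟩
      E (suc r) + (Λ - 1ℚ - 1ℚ) * D (suc r)        ≡⟨ cong (_+ (Λ - 1ℚ - 1ℚ) * D (suc r)) (equalEnds-suc r) ⟩
      (Λ - 1ℚ) * D r + (Λ - 1ℚ - 1ℚ) * D (suc r)   ≡⟨ cong₂ (λ x y → (Λ - 1ℚ) * x + (Λ - 1ℚ - 1ℚ) * y)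
                                                           (γ≡distinctEnds r) (γ≡distinctEnds (suc r)) ⟨
      (Λ - 1ℚ) * γ (2 ℕ.+ r) Λ + (Λ - 1ℚ - 1ℚ) * γ (3 ℕ.+ r) Λ ∎
      where open ≡-Reasoning

    ℕtoℚ-bookCount : ∀ r N → ℕtoℚ (q ℕ.* (equalEnds t (suc r) ℕ.^ N ℕ.+ t ℕ.* distinctEnds t (suc r) ℕ.^ N))
                             ≡ bookPolynomial Λ (γ (2 ℕ.+ r) Λ) (γ (3 ℕ.+ r) Λ) N
    ℕtoℚ-bookCount r N = begin
      ℕtoℚ (q ℕ.* (equalEnds t (suc r) ℕ.^ N ℕ.+ t ℕ.* distinctEnds t (suc r) ℕ.^ N))
        ≡⟨ trans (ℕtoℚ-* q (e ℕ.^ N ℕ.+ t ℕ.* d ℕ.^ N)) (cong (Λ *_) (trans (ℕtoℚ-+ (e ℕ.^ N) (t ℕ.* d ℕ.^ N))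
             (cong₂ _+_ (ℕtoℚ-^ e N) (trans (ℕtoℚ-* t (d ℕ.^ N)) (cong (ℕtoℚ t *_) (ℕtoℚ-^ d N)))))) ⟩
      Λ * (E (suc r) ^ N + ℕtoℚ t * D (suc r) ^ N)
        ≡⟨ cong₂ (λ x y → Λ * (x ^ N + y * D (suc r) ^ N)) (equalEnds-suc r) t≡Λ-2 ⟩
      Λ * (((Λ - 1ℚ) * D r) ^ N + (Λ - 1ℚ - 1ℚ) * D (suc r) ^ N)
        ≡⟨ cong₂ (λ a b → bookPolynomial Λ a b N) (γ≡distinctEnds r) (γ≡distinctEnds (suc r)) ⟨
      bookPolynomial Λ (γ (2 ℕ.+ r) Λ) (γ (3 ℕ.+ r) Λ) N ∎
      where
      open ≡-Reasoning
      e d : ℕ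
      e = equalEnds t (suc r)
      d = distinctEnds t (suc r)

  χbook≡bookPolynomial : ∀ k p N → let Λ = twice (suc k) in
    ℕtoℚ (χbook (3 ℕ.+ p) N (suc k)) ≡ bookPolynomial Λ (γ (2 ℕ.+ p) Λ) (γ (3 ℕ.+ p) Λ) N
  χbook≡bookPolynomial k p N =
    trans (cong ℕtoℚ (BookColourings.χbook≡ (suc k) p N (2 ℕ.* k) 2[1+k]≡2+2k))
          (PathCounts.ℕtoℚ-bookCount (2 ℕ.* suc k) (2 ℕ.* k) 2[1+k]≡2+2k p N)
    where
    2[1+k]≡2+2k : 2 ℕ.* suc k ≡ 2 ℕ.+ 2 ℕ.* k
    2[1+k]≡2+2k = *-suc 2 k

open import Defs
open import Data.Nat using (ℕ; suc; _≤_; _∸_)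
open import Data.Product using (_×_)
open import Data.Rational using (ℚ; _+_; _-_; _*_; -_; 1ℚ)
open import Relation.Binary.PropositionalEquality using (_≡_)

open import Data.Nat as ℕ using (s≤s; z≤n)
open import Data.Nat.Properties using (*-suc)
open import Data.Product using (_,_)
open import Relation.Binary.PropositionalEquality using (cong; trans; module ≡-Reasoning)
open Rationals using (bookPolynomial; χbook≡bookPolynomial; bookPolynomial-suc; bookPolynomial-closedForm; sign²; module PathCounts)

theorem4p6 : (m n k : ℕ) → 3 ≤ m → 2 ≤ n → 1 ≤ k →
    let λ′ = twice k in
    (ℕtoℚ (χbook m n k) ≡
       (λ′ - 1ℚ) * γ (m ∸ 1) λ′ * ℕtoℚ (χbook m (n ∸ 1) k)
       + (- 1ℚ) ^ (m ∸ 2) * λ′ * (λ′ - 1ℚ - 1ℚ) * γ m λ′ ^ (n ∸ 1))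
    × (ℕtoℚ (χbook m n k) ≡
       λ′ * (λ′ - 1ℚ) ^ (n ∸ 1) * γ (m ∸ 1) λ′ ^ (n ∸ 1) * γ (suc m) λ′
       + (- 1ℚ) ^ (m ∸ 2) * λ′ * (λ′ - 1ℚ - 1ℚ) * γ m λ′
         * (((λ′ - 1ℚ) ^ (n ∸ 1) * γ (m ∸ 1) λ′ ^ (n ∸ 1) - γ m λ′ ^ (n ∸ 1))
            /' ((λ′ - 1ℚ) * γ (m ∸ 1) λ′ - γ m λ′)))
theorem4p6 (suc (suc (suc p))) (suc (suc n)) (suc k) (s≤s (s≤s (s≤s z≤n))) (s≤s (s≤s z≤n)) (s≤s z≤n) =
  recurrence , closedForm
  where
  open PathCounts (2 ℕ.* suc k) (2 ℕ.* k) (*-suc 2 k) using (Λ; γ-suc; γ-suc-suc)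

  a b c e : ℚ
  a = γ (2 ℕ.+ p) Λ
  b = γ (3 ℕ.+ p) Λ
  c = γ (4 ℕ.+ p) Λ
  e = (- 1ℚ) ^ suc p

  χ : ℕ → ℚ
  χ N = ℕtoℚ (χbook (3 ℕ.+ p) N (suc k))

  recurrence : χ (2 ℕ.+ n) ≡ (Λ - 1ℚ) * a * χ (suc n) + e * Λ * (Λ - 1ℚ - 1ℚ) * b ^ suc n
  recurrence = begin
    χ (2 ℕ.+ n)
      ≡⟨ χbook≡bookPolynomial k p (2 ℕ.+ n) ⟩
    bookPolynomial Λ a b (2 ℕ.+ n)
      ≡⟨ bookPolynomial-suc {Λ} {a} {b} {e} (suc n) (γ-suc p) ⟩
    (Λ - 1ℚ) * a * bookPolynomial Λ a b (suc n) + e * Λ * (Λ - 1ℚ - 1ℚ) * b ^ suc n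
      ≡⟨ cong (λ x → (Λ - 1ℚ) * a * x + e * Λ * (Λ - 1ℚ - 1ℚ) * b ^ suc n) (χbook≡bookPolynomial k p (suc n)) ⟨
    (Λ - 1ℚ) * a * χ (suc n) + e * Λ * (Λ - 1ℚ - 1ℚ) * b ^ suc n ∎
    where open ≡-Reasoning

  closedForm : χ (2 ℕ.+ n) ≡ Λ * (Λ - 1ℚ) ^ suc n * a ^ suc n * c
                             + e * Λ * (Λ - 1ℚ - 1ℚ) * b
                               * (((Λ - 1ℚ) ^ suc n * a ^ suc n - b ^ suc n) /' ((Λ - 1ℚ) * a - b))
  closedForm = trans (χbook≡bookPolynomial k p (2 ℕ.+ n))
                     (bookPolynomial-closedForm {Λ} {a} {b} {c} {e} (suc n) (γ-suc p) (γ-suc-suc p) (sign² (suc p)))
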